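{- A graph $G$ is a half-square of a star convex bipartite graph (i.e., there is a star convex bipartite graph $B=(V(G),W,E_B)$ with $G=B^2[V(G)]$) if and only if (i) $G$ has at most one big connected component and the big connected component (if any) has a universal vertex, or (ii) $G$ is obtained from a split graph by substituting vertices by cliques.
   Context: For a bipartite graph $B=(X,Y,E_B)$, the half-square $B^2[X]$ is the graph on $X$ where two distinct vertices are adjacent iff they have a common neighbor in $Y$. $B$ is tree $X$-convex if there is a tree $T$ on vertex set $X$ such that for each $y\in Y$, the neighborhood $N(y)$ induces a subtree of $T$; tree $Y$-convex is defined symmetrically. $B$ is star convex if it is tree $X$-convex or tree $Y$-convex with the tree $T$ being a star. A connected component is big if it has at least two vertices; a universal vertex of a (connected) graph is adjacent to all other vertices of it. A split graph is a graph whose vertex set can be partitioned into a clique and a stable set. Substituting a vertex $v$ of a graph $G$ by a graph $H$ (vertex-disjoint from $G$) yields the graph obtained from $G-v$ and $H$ by adding all edges between $N_G(v)$ and $V(H)$; "substituting vertices by cliques" means substituting some vertices, each by a (nonempty) complete graph. -}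

module Defs where

open import Data.Nat using (ℕ)
open import Data.Fin using (Fin)
open import Data.Bool using (Bool; true; false; T)
open import Data.Product using (Σ; ∃; ∃-syntax; _×_; _,_)
open import Data.Sum using (_⊎_)
open import Data.Unit using (⊤)
open import Relation.Binary.PropositionalEquality using (_≡_; _≢_)
open import Function.Bundles using (_⇔_)

record Graph (n : ℕ) : Set where
  field
    adj    : Fin n → Fin n → Bool
    sym    : ∀ u v → adj u v ≡ adj v u
    irrefl : ∀ u → adj u u ≡ false
open Graph public

Adj : ∀ {n} → Graph n → Fin n → Fin n → Set
Adj G u v = T (adj G u v)

data WalkIn {k : ℕ} (R : Fin k → Fin k → Set) (S : Fin k → Set) : Fin k → Fin k → Set where
  here : ∀ {u} → S u → WalkIn R S u u
  step : ∀ {u v w} → S u → R u v → WalkIn R S v w → WalkIn R S u w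

Reach : ∀ {n} → Graph n → Fin n → Fin n → Set
Reach G = WalkIn (Adj G) (λ _ → ⊤)

BigAt : ∀ {n} → Graph n → Fin n → Set
BigAt G u = ∃[ v ] (v ≢ u × Reach G u v)

CondI : ∀ {n} → Graph n → Set
CondI G =
  (∀ u v → BigAt G u → BigAt G v → Reach G u v) ×
  (∀ u → BigAt G u → ∃[ c ] (Reach G u c × (∀ v → Reach G u v → v ≢ c → Adj G c v)))

IsSplit : ∀ {k} → Graph k → Set
IsSplit {k} H = Σ (Fin k → Bool) λ inK →
  (∀ u v → u ≢ v → inK u ≡ true → inK v ≡ true → Adj H u v) ×
  (∀ u v → inK u ≡ false → inK v ≡ false → ¬Adj u v)
  where
  ¬Adj : Fin k → Fin k → Set
  ¬Adj u v = adj H u v ≡ false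

-- (ii) G is (isomorphic to) the graph obtained from a split graph H by substituting each
-- vertex h of H by a nonempty clique: f maps each vertex of G to the vertex of H whose
-- clique it belongs to (f surjective = cliques nonempty; a singleton clique = no substitution).
CondII : ∀ {n} → Graph n → Set
CondII {n} G = Σ ℕ λ k → Σ (Graph k) λ H → Σ (Fin n → Fin k) λ f →
  IsSplit H ×
  (∀ h → ∃[ u ] (f u ≡ h)) ×
  (∀ u v → Adj G u v ⇔ (u ≢ v × (f u ≡ f v ⊎ Adj H (f u) (f v))))

StarAdj : ∀ {k} → Fin k → Fin k → Fin k → Set
StarAdj c u v = u ≢ v × (u ≡ c ⊎ v ≡ c)

InducesSubtree : ∀ {k} → (Fin k → Fin k → Set) → (Fin k → Set) → Set
InducesSubtree {k} R S = (∃[ u ] S u) × (∀ u v → S u → S v → WalkIn R S u v)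

StarXConvex : ∀ {n m} → (Fin n → Fin m → Bool) → Set
StarXConvex {n} {m} E = ∃[ c ] (∀ (y : Fin m) → InducesSubtree (StarAdj c) (λ x → T (E x y)))

StarYConvex : ∀ {n m} → (Fin n → Fin m → Bool) → Set
StarYConvex {n} {m} E = ∃[ c ] (∀ (x : Fin n) → InducesSubtree (StarAdj c) (λ y → T (E x y)))

StarConvex : ∀ {n m} → (Fin n → Fin m → Bool) → Set
StarConvex E = StarXConvex E ⊎ StarYConvex E

IsHalfSquare : ∀ {n m} → Graph n → (Fin n → Fin m → Bool) → Set
IsHalfSquare {n} {m} G E = ∀ u v → Adj G u v ⇔ (u ≢ v × ∃[ y ] (T (E u y) × T (E v y)))

HalfSquareOfStarConvex : ∀ {n} → Graph n → Set
HalfSquareOfStarConvex G = Σ ℕ λ m → Σ (_ → Fin m → Bool) λ E → StarConvex E × IsHalfSquare G E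

-- Let B = (V(G), W, E) with G = B²[V(G)].  The two kinds of star convexity
-- lead to the two alternatives of the theorem.
--
-- * Star X-convex with centre c.  Every W-neighbourhood containing two
--   vertices contains c, so c is adjacent to every non-isolated vertex of G:
--   c is DOMINATING.  A graph has a dominating vertex iff it satisfies (i)
--   (for nonempty vertex sets), and conversely a dominating vertex c is
--   realised by one W-vertex {c, a, b} per edge ab.
-- * Star Y-convex with centre c.  A vertex of G not adjacent to c has a unique
--   neighbour in W.  Substituting the vertices adjacent to c (a clique) and the
--   W-vertices (a stable set) gives a split substitution (ii); its vertex set is
--   compressed to some Fin k by an image factorisation.  Conversely a split
--   graph H is realised by a hub (adjacent to the clique) and one private
--   W-vertex per vertex of H, and this representation pulls back along the
--   substitution map.
module Submission where

open import Defs
open import Data.Nat using (ℕ; zero; suc; _*_)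
open import Data.Fin using (Fin; zero; suc; _≟_; combine; remQuot)
open import Data.Fin.Properties using (any?; remQuot-combine)
open import Data.Bool using (Bool; true; false; T)
import Data.Bool.Properties as Bool
open import Data.Product using (∃-syntax; _×_; _,_; proj₁; proj₂)
open import Data.Product.Function.NonDependent.Propositional using (_×-⇔_)
open import Data.Sum using (_⊎_; inj₁; inj₂)
import Data.Sum.Properties as Sum
open import Data.Unit using (⊤; tt)
open import Data.Empty using (⊥; ⊥-elim)
open import Function using (_∘_; id)
open import Function.Bundles using (_⇔_; mk⇔; Equivalence)
open import Function.Construct.Identity using (⇔-id)
import Function.Properties.Equivalence as ⇔
open import Relation.Nullary using (¬_; Dec; yes; no; ¬?)
open import Relation.Nullary.Decidable
  using (⌊_⌋; toWitness; fromWitness; isYes≗does; dec-false; _×-dec_; _⊎-dec_; T?)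
open import Relation.Binary.Definitions using (DecidableEquality)
open import Relation.Binary.PropositionalEquality
  using (_≡_; _≢_; refl; trans; cong; subst; subst₂; ≢-sym)
  renaming (sym to ≡-sym)

open Equivalence using (to; from)

module _ {k : ℕ} {R : Fin k → Fin k → Set} {S : Fin k → Set} where

  _++ʷ_ : ∀ {u v w} → WalkIn R S u v → WalkIn R S v w → WalkIn R S u w
  here _     ++ʷ q = q
  step s r p ++ʷ q = step s r (p ++ʷ q)

  walk-start : ∀ {u v} → WalkIn R S u v → S u
  walk-start (here s)     = s
  walk-start (step s _ _) = s

  reverse : (∀ {a b} → R a b → R b a) → ∀ {u v} → WalkIn R S u v → WalkIn R S v u
  reverse R-sym (here s)     = here s
  reverse R-sym (step s r p) =
    reverse R-sym p ++ʷ step (walk-start p) (R-sym r) (here s)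

module _ {k : ℕ} (c : Fin k) {S : Fin k → Set} where

  -- A set containing the centre induces a subtree: route every walk through c.
  centre⇒subtree : S c → InducesSubtree (StarAdj c) S
  centre⇒subtree sc = (c , sc) , λ u v su sv → to-centre u su ++ʷ from-centre v sv
    where
    to-centre : ∀ u → S u → WalkIn (StarAdj c) S u c
    to-centre u su with u ≟ c
    ... | yes refl = here sc
    ... | no u≢c   = step su (u≢c , inj₂ refl) (here sc)

    from-centre : ∀ v → S v → WalkIn (StarAdj c) S c v
    from-centre v sv with v ≟ c
    ... | yes refl = here sc
    ... | no v≢c   = step sc (≢-sym v≢c , inj₁ refl) (here sv)

  singleton⇒subtree : ∀ {x} → S x → (∀ y → S y → y ≡ x) → InducesSubtree (StarAdj c) S
  singleton⇒subtree {x} sx only = (x , sx) , λ u v su sv →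
    subst (WalkIn (StarAdj c) S u) (trans (only u su) (≡-sym (only v sv))) (here su)

  -- Conversely, a subtree of a star with two distinct vertices contains the
  -- centre, since every edge of the star is incident to c.
  subtree-centre : InducesSubtree (StarAdj c) S → ∀ {u v} → S u → S v → u ≢ v → S c
  subtree-centre (_ , connected) su sv = walk-centre (connected _ _ su sv)
    where
    walk-centre : ∀ {u v} → WalkIn (StarAdj c) S u v → u ≢ v → S c
    walk-centre (here _)                    u≢u = ⊥-elim (u≢u refl)
    walk-centre (step su (_ , inj₁ refl) _) _   = su
    walk-centre (step _ (_ , inj₂ refl) p)  _   = walk-start p

module _ {n : ℕ} (G : Graph n) where

  adj-sym : ∀ {u v} → Adj G u v → Adj G v u
  adj-sym {u} {v} = subst T (sym G u v)

  adj-≢ : ∀ {u v} → Adj G u v → u ≢ v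
  adj-≢ {u} uu refl = subst T (irrefl G u) uu

  reach-sym : ∀ {u v} → Reach G u v → Reach G v u
  reach-sym = reverse adj-sym

  first-edge : ∀ {u v} → Reach G u v → u ≢ v → ∃[ w ] Adj G u w
  first-edge (here _)     u≢u = ⊥-elim (u≢u refl)
  first-edge (step _ a _) _   = _ , a

  edge⇒big : ∀ {u w} → Adj G u w → BigAt G u
  edge⇒big {w = w} uw = w , ≢-sym (adj-≢ uw) , step tt uw (here tt)

Dominating : ∀ {n} → Graph n → Fin n → Set
Dominating G c = ∀ u v → Adj G u v → u ≢ c → Adj G c u

module _ {n} (G : Graph n) {c : Fin n} (dominating : Dominating G c) where

  big⇒reach-centre : ∀ {u} → BigAt G u → Reach G u c
  big⇒reach-centre {u} (w , w≢u , uw) with u ≟ c | first-edge G uw (≢-sym w≢u)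
  ... | yes refl | _        = here tt
  ... | no u≢c   | (_ , ux) = step tt (adj-sym G (dominating _ _ ux u≢c)) (here tt)

  dominating⇒CondI : CondI G
  dominating⇒CondI =
    (λ u v bu bv → big⇒reach-centre bu ++ʷ reach-sym G (big⇒reach-centre bv)) ,
    λ u bu → c , big⇒reach-centre bu , λ v uv v≢c →
      let (w , vw) = first-edge G (reach-sym G uv ++ʷ big⇒reach-centre bu) v≢c
      in dominating v w vw v≢c

-- Conversely, under (i) the universal vertex of the big component dominates;
-- without edges any vertex dominates.
CondI⇒dominating : ∀ {n} (G : Graph n) → CondI G → Fin n → ∃[ c ] Dominating G c
CondI⇒dominating G (one-big , universal) x
  with any? (λ a → any? (λ b → T? (adj G a b)))
... | no no-edge = x , λ u v uv _ → ⊥-elim (no-edge (u , v , uv))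
... | yes (a , b , ab) =
  let (c , _ , c-universal) = universal a (edge⇒big G ab)
  in c , λ u v uv u≢c → c-universal u (one-big a u (edge⇒big G ab) (edge⇒big G uv)) u≢c

-- The centre of a star X-convex representation is dominating: the W-vertex of an
-- edge uv is adjacent to u, v, hence to the centre.
xConvex⇒dominating : ∀ {n m} (G : Graph n) (E : Fin n → Fin m → Bool) (c : Fin n) →
  (∀ y → InducesSubtree (StarAdj c) (λ x → T (E x y))) → IsHalfSquare G E →
  Dominating G c
xConvex⇒dominating G E c convex half-square u v uv u≢c
  with to (half-square u v) uv
... | u≢v , y , uy , vy =
  from (half-square c u) (≢-sym u≢c , y , subtree-centre c (convex y) uy vy u≢v , uy)

-- A dominating vertex c is realised by a star X-convex graph with centre c and
-- one W-vertex per pair (a, b), adjacent to c and, when ab is an edge, to a, b.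
module DominatingRepresentation {n} (G : Graph n) (c : Fin n) (dominating : Dominating G c) where

  OnPair : Fin n → Fin n × Fin n → Set
  OnPair x (a , b) = x ≡ c ⊎ (Adj G a b × (x ≡ a ⊎ x ≡ b))

  onPair? : ∀ x p → Dec (OnPair x p)
  onPair? x (a , b) = x ≟ c ⊎-dec (T? (adj G a b) ×-dec (x ≟ a ⊎-dec x ≟ b))

  E : Fin n → Fin (n * n) → Bool
  E x y = ⌊ onPair? x (remQuot n y) ⌋

  endpoint-dominated : ∀ {a b x} → Adj G a b → x ≡ a ⊎ x ≡ b → x ≢ c → Adj G c x
  endpoint-dominated ab (inj₁ refl) = dominating _ _ ab
  endpoint-dominated ab (inj₂ refl) = dominating _ _ (adj-sym G ab)

  endpoints-adjacent : ∀ {a b u v} → Adj G a b →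
    u ≡ a ⊎ u ≡ b → v ≡ a ⊎ v ≡ b → u ≢ v → Adj G u v
  endpoints-adjacent ab (inj₁ refl) (inj₁ refl) u≢u = ⊥-elim (u≢u refl)
  endpoints-adjacent ab (inj₁ refl) (inj₂ refl) _   = ab
  endpoints-adjacent ab (inj₂ refl) (inj₁ refl) _   = adj-sym G ab
  endpoints-adjacent ab (inj₂ refl) (inj₂ refl) u≢u = ⊥-elim (u≢u refl)

  onPair⇒adjacent : ∀ {u v} p → u ≢ v → OnPair u p → OnPair v p → Adj G u v
  onPair⇒adjacent _ u≢v (inj₁ refl) (inj₁ refl) = ⊥-elim (u≢v refl)
  onPair⇒adjacent _ u≢v (inj₁ refl) (inj₂ (ab , v∈)) = endpoint-dominated ab v∈ (≢-sym u≢v)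
  onPair⇒adjacent _ u≢v (inj₂ (ab , u∈)) (inj₁ refl) = adj-sym G (endpoint-dominated ab u∈ u≢v)
  onPair⇒adjacent _ u≢v (inj₂ (ab , u∈)) (inj₂ (_ , v∈)) = endpoints-adjacent ab u∈ v∈ u≢v

  edge-witness : ∀ {u v} → Adj G u v → T (E u (combine u v)) × T (E v (combine u v))
  edge-witness {u} {v} uv = on-edge (inj₁ refl) , on-edge (inj₂ refl)
    where
    on-edge : ∀ {x} → x ≡ u ⊎ x ≡ v → T (E x (combine u v))
    on-edge {x} x∈ = subst (λ p → T ⌊ onPair? x p ⌋) (≡-sym (remQuot-combine {n} {n} u v))
                       (fromWitness (inj₂ (uv , x∈)))

  representation : HalfSquareOfStarConvex G
  representation =
    n * n , E , inj₁ (c , λ y → centre⇒subtree c (fromWitness (inj₁ refl))) , λ u v → mk⇔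
      (λ uv → adj-≢ G uv , combine u v , edge-witness uv)
      (λ (u≢v , y , uy , vy) → onPair⇒adjacent (remQuot n y) u≢v (toWitness uy) (toWitness vy))

empty-representation : (G : Graph 0) → HalfSquareOfStarConvex G
empty-representation G = 1 , (λ ()) , inj₂ (zero , λ ()) , λ ()

CondI⇒halfSquare : ∀ n (G : Graph n) → CondI G → HalfSquareOfStarConvex G
CondI⇒halfSquare zero    G _     = empty-representation G
CondI⇒halfSquare (suc n) G condI =
  let (c , dominating) = CondI⇒dominating G condI zero
  in DominatingRepresentation.representation G c dominating

-- A map g from Fin n factors as a surjection onto some Fin size followed by an
-- injection; used to give the split graph of a substitution a finite vertex set.
record ImageFactorisation {n : ℕ} {A : Set} (g : Fin n → A) : Set where
  field
    size            : ℕ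
    embed           : Fin size → A
    onto            : Fin n → Fin size
    embed-injective : ∀ i j → embed i ≡ embed j → i ≡ j
    onto-surjective : ∀ i → ∃[ x ] (onto x ≡ i)
    factors         : ∀ x → embed (onto x) ≡ g x

module _ {A : Set} {n : ℕ} {g : Fin (suc n) → A} (F : ImageFactorisation (g ∘ suc)) where
  open ImageFactorisation F

  extend-old : ∀ i → embed i ≡ g zero → ImageFactorisation g
  extend-old i i↦g0 = record
    { size = size ; embed = embed ; onto = onto′ ; embed-injective = embed-injective
    ; onto-surjective = λ j → let (x , x↦j) = onto-surjective j in suc x , x↦j
    ; factors = factors′ }
    where
    onto′ : Fin (suc n) → Fin size
    onto′ zero    = i
    onto′ (suc x) = onto x

    factors′ : ∀ x → embed (onto′ x) ≡ g x
    factors′ zero    = i↦g0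
    factors′ (suc x) = factors x

  extend-new : (∀ i → embed i ≢ g zero) → ImageFactorisation g
  extend-new new = record
    { size = suc size ; embed = embed′ ; onto = onto′ ; embed-injective = injective′
    ; onto-surjective = surjective′ ; factors = factors′ }
    where
    embed′ : Fin (suc size) → A
    embed′ zero    = g zero
    embed′ (suc i) = embed i

    onto′ : Fin (suc n) → Fin (suc size)
    onto′ zero    = zero
    onto′ (suc x) = suc (onto x)

    injective′ : ∀ i j → embed′ i ≡ embed′ j → i ≡ j
    injective′ zero    zero    _  = refl
    injective′ zero    (suc j) eq = ⊥-elim (new j (≡-sym eq))
    injective′ (suc i) zero    eq = ⊥-elim (new i eq)
    injective′ (suc i) (suc j) eq = cong suc (embed-injective i j eq)

    surjective′ : ∀ i → ∃[ x ] (onto′ x ≡ i)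
    surjective′ zero    = zero , refl
    surjective′ (suc i) = let (x , x↦i) = onto-surjective i in suc x , cong suc x↦i

    factors′ : ∀ x → embed′ (onto′ x) ≡ g x
    factors′ zero    = refl
    factors′ (suc x) = factors x

image-factorisation : {A : Set} → DecidableEquality A → ∀ {n} (g : Fin n → A) →
  ImageFactorisation g
image-factorisation _ {zero} g = record
  { size = 0 ; embed = λ () ; onto = λ () ; embed-injective = λ ()
  ; onto-surjective = λ () ; factors = λ () }
image-factorisation _≟A_ {suc n} g
  with F ← image-factorisation _≟A_ (g ∘ suc)
  with any? (λ i → ImageFactorisation.embed F i ≟A g zero)
... | yes (i , i↦g0) = extend-old F i i↦g0
... | no  absent     = extend-new F (λ i i↦g0 → absent (i , i↦g0))

-- G arises from a split graph on a type A by substituting each vertex p by the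
-- clique of those u with class u ≡ p.  Unlike CondII, A need not be finite and
-- the class map need not be onto.
record SplitSubstitution {n : ℕ} (G : Graph n) (A : Set) : Set₁ where
  field
    _≟A_        : DecidableEquality A
    Edge        : A → A → Set
    edge?       : ∀ p q → Dec (Edge p q)
    edge-sym    : ∀ {p q} → Edge p q → Edge q p
    edge-irrefl : ∀ {p} → ¬ Edge p p
    inClique    : A → Bool
    clique      : ∀ p q → p ≢ q → inClique p ≡ true → inClique q ≡ true → Edge p q
    stable      : ∀ p q → inClique p ≡ false → inClique q ≡ false → ¬ Edge p q
    class       : Fin n → A
    adjacency   : ∀ u v → Adj G u v ⇔ (u ≢ v × (class u ≡ class v ⊎ Edge (class u) (class v)))

-- Restricting the split graph to the image of the class map yields (ii).
splitSubstitution⇒CondII : ∀ {n} {G : Graph n} {A} → SplitSubstitution G A → CondII G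
splitSubstitution⇒CondII S =
  size , H , onto , (inClique ∘ embed , clique-H , stable-H) , onto-surjective ,
  λ u v → ⇔.trans (adjacency u v) (⇔-id _ ×-⇔ relocate u v)
  where
  open SplitSubstitution S
  open ImageFactorisation (image-factorisation _≟A_ class)

  edge-decision-sym : ∀ p q → ⌊ edge? p q ⌋ ≡ ⌊ edge? q p ⌋
  edge-decision-sym p q with edge? p q | edge? q p
  ... | yes _  | yes _  = refl
  ... | no _   | no _   = refl
  ... | yes e  | no ¬e′ = ⊥-elim (¬e′ (edge-sym e))
  ... | no ¬e  | yes e′ = ⊥-elim (¬e (edge-sym e′))

  non-edge : ∀ {p q} → ¬ Edge p q → ⌊ edge? p q ⌋ ≡ false
  non-edge {p} {q} ¬e = trans (isYes≗does (edge? p q)) (dec-false (edge? p q) ¬e)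

  H : Graph size
  H = record
    { adj    = λ i j → ⌊ edge? (embed i) (embed j) ⌋
    ; sym    = λ i j → edge-decision-sym (embed i) (embed j)
    ; irrefl = λ i → non-edge edge-irrefl }

  clique-H : ∀ i j → i ≢ j → inClique (embed i) ≡ true → inClique (embed j) ≡ true → Adj H i j
  clique-H i j i≢j ci cj = fromWitness (clique _ _ (i≢j ∘ embed-injective i j) ci cj)

  stable-H : ∀ i j → inClique (embed i) ≡ false → inClique (embed j) ≡ false → adj H i j ≡ false
  stable-H i j si sj = non-edge (stable _ _ si sj)

  relocate : ∀ u v → (class u ≡ class v ⊎ Edge (class u) (class v)) ⇔
                     (onto u ≡ onto v ⊎ Adj H (onto u) (onto v))
  relocate u v = mk⇔
    (λ { (inj₁ same) → inj₁ (embed-injective _ _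
           (trans (factors u) (trans same (≡-sym (factors v)))))
       ; (inj₂ e) → inj₂ (fromWitness (subst₂ Edge (≡-sym (factors u)) (≡-sym (factors v)) e)) })
    (λ { (inj₁ same) → inj₁ (trans (≡-sym (factors u)) (trans (cong embed same) (factors v)))
       ; (inj₂ a) → inj₂ (subst₂ Edge (factors u) (factors v) (toWitness a)) })

-- A star Y-convex representation with centre c gives a split substitution: the
-- clique consists of the vertices of G adjacent to c, the stable set is W, and
-- a vertex not adjacent to c is substituted into its unique neighbour.
module YConvex {n m} (G : Graph n) (E : Fin n → Fin m → Bool) (c : Fin m)
  (convex : ∀ x → InducesSubtree (StarAdj c) (λ y → T (E x y)))
  (half-square : IsHalfSquare G E) where

  some-nbr : Fin n → Fin m
  some-nbr x = proj₁ (proj₁ (convex x))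

  some-nbr-adj : ∀ x → T (E x (some-nbr x))
  some-nbr-adj x = proj₂ (proj₁ (convex x))

  unique-nbr : ∀ {x y} → ¬ T (E x c) → T (E x y) → y ≡ some-nbr x
  unique-nbr {x} {y} x≁c xy with y ≟ some-nbr x
  ... | yes same = same
  ... | no y≢    = ⊥-elim (x≁c (subtree-centre c (convex x) xy (some-nbr-adj x) y≢))

  Vertex : Set
  Vertex = Fin n ⊎ Fin m

  Edge : Vertex → Vertex → Set
  Edge (inj₁ a) (inj₁ b) = a ≢ b
  Edge (inj₁ a) (inj₂ y) = T (E a y)
  Edge (inj₂ y) (inj₁ b) = T (E b y)
  Edge (inj₂ _) (inj₂ _) = ⊥

  edge? : ∀ p q → Dec (Edge p q)
  edge? (inj₁ a) (inj₁ b) = ¬? (a ≟ b)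
  edge? (inj₁ a) (inj₂ y) = T? (E a y)
  edge? (inj₂ y) (inj₁ b) = T? (E b y)
  edge? (inj₂ _) (inj₂ _) = no id

  edge-sym : ∀ {p q} → Edge p q → Edge q p
  edge-sym {inj₁ _} {inj₁ _} a≢b = ≢-sym a≢b
  edge-sym {inj₁ _} {inj₂ _} e   = e
  edge-sym {inj₂ _} {inj₁ _} e   = e

  edge-irrefl : ∀ {p} → ¬ Edge p p
  edge-irrefl {inj₁ a} a≢a = a≢a refl

  inClique : Vertex → Bool
  inClique (inj₁ _) = true
  inClique (inj₂ _) = false

  clique : ∀ p q → p ≢ q → inClique p ≡ true → inClique q ≡ true → Edge p q
  clique (inj₁ a) (inj₁ b) p≢q _ _ = p≢q ∘ cong inj₁

  stable : ∀ p q → inClique p ≡ false → inClique q ≡ false → ¬ Edge p q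
  stable (inj₂ _) (inj₂ _) _ _ ()

  class : Fin n → Vertex
  class x with T? (E x c)
  ... | yes _ = inj₁ x
  ... | no _  = inj₂ (some-nbr x)

  Touches : Vertex → Fin m → Set
  Touches (inj₁ a) y = T (E a y)
  Touches (inj₂ z) y = y ≡ z

  Valid : Vertex → Set
  Valid (inj₁ a) = T (E a c)
  Valid (inj₂ _) = ⊤

  class-valid : ∀ x → Valid (class x)
  class-valid x with T? (E x c)
  ... | yes x∼c = x∼c
  ... | no _    = tt

  class-touches : ∀ x y → T (E x y) ⇔ Touches (class x) y
  class-touches x y with T? (E x c)
  ... | yes _   = ⇔-id _
  ... | no x≁c = mk⇔ (unique-nbr x≁c) (λ { refl → some-nbr-adj x })

  common-touch : ∀ {p q} → Valid p → Valid q →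
    (∃[ y ] (Touches p y × Touches q y)) ⇔ (p ≡ q ⊎ Edge p q)
  common-touch {inj₁ a} {inj₁ b} a∼c b∼c with a ≟ b
  ... | yes refl = mk⇔ (λ _ → inj₁ refl) (λ _ → c , a∼c , b∼c)
  ... | no a≢b   = mk⇔ (λ _ → inj₂ a≢b) (λ _ → c , a∼c , b∼c)
  common-touch {inj₁ a} {inj₂ z} _ _ = mk⇔
    (λ { (y , ay , refl) → inj₂ ay })
    (λ { (inj₁ ()) ; (inj₂ az) → z , az , refl })
  common-touch {inj₂ z} {inj₁ b} _ _ = mk⇔
    (λ { (y , refl , by) → inj₂ by })
    (λ { (inj₁ ()) ; (inj₂ bz) → z , refl , bz })
  common-touch {inj₂ z} {inj₂ _} _ _ = mk⇔
    (λ { (y , refl , refl) → inj₁ refl })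
    (λ { (inj₁ refl) → z , refl , refl ; (inj₂ ()) })

  common-class : ∀ u v → (∃[ y ] (T (E u y) × T (E v y))) ⇔
                         (class u ≡ class v ⊎ Edge (class u) (class v))
  common-class u v = ⇔.trans
    (mk⇔ (λ (y , uy , vy) → y , to (class-touches u y) uy , to (class-touches v y) vy)
         (λ (y , uy , vy) → y , from (class-touches u y) uy , from (class-touches v y) vy))
    (common-touch (class-valid u) (class-valid v))

  splitSubstitution : SplitSubstitution G Vertex
  splitSubstitution = record
    { _≟A_        = Sum.≡-dec _≟_ _≟_
    ; Edge        = Edge
    ; edge?       = edge?
    ; edge-sym    = λ {p} {q} → edge-sym {p} {q}
    ; edge-irrefl = λ {p} → edge-irrefl {p}
    ; inClique    = inClique
    ; clique      = clique
    ; stable      = stable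
    ; class       = class
    ; adjacency = λ u v → ⇔.trans (half-square u v) (⇔-id _ ×-⇔ common-class u v) }

-- A split graph H is represented, up to reflexive closure, by a star Y-convex
-- graph with W = {hub} ∪ {private vertex of h}: the hub (zero) is adjacent to
-- the clique, the private vertex of h to h and, if h is stable, its neighbours.
module SplitRepresentation {k} (H : Graph k) (inK : Fin k → Bool)
  (clique : ∀ u v → u ≢ v → inK u ≡ true → inK v ≡ true → Adj H u v)
  (stable : ∀ u v → inK u ≡ false → inK v ≡ false → adj H u v ≡ false) where

  Member : Fin k → Fin (suc k) → Set
  Member a zero    = inK a ≡ true
  Member a (suc h) = a ≡ h ⊎ (inK h ≡ false × Adj H a h)

  member? : ∀ a y → Dec (Member a y)
  member? a zero    = inK a Bool.≟ true
  member? a (suc h) = a ≟ h ⊎-dec (inK h Bool.≟ false ×-dec T? (adj H a h))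

  E : Fin k → Fin (suc k) → Bool
  E a y = ⌊ member? a y ⌋

  nbr-of-stable : ∀ {a h} → inK h ≡ false → Adj H a h → inK a ≡ true
  nbr-of-stable {a} {h} sh ah with inK a in ia
  ... | true  = refl
  ... | false = ⊥-elim (subst T (stable a h ia sh) ah)

  only-private : ∀ {a} → inK a ≡ false → ∀ y → Member a y → y ≡ suc a
  only-private sa zero    ka with () ← trans (≡-sym ka) sa
  only-private sa (suc h) (inj₁ refl)      = refl
  only-private sa (suc h) (inj₂ (sh , ah)) = ⊥-elim (subst T (stable _ h sa sh) ah)

  star-convex : ∀ a → InducesSubtree (StarAdj zero) (λ y → T (E a y))
  star-convex a with inK a in ia
  ... | true  = centre⇒subtree zero (fromWitness ia)
  ... | false = singleton⇒subtree zero (fromWitness (inj₁ refl)) (λ y → only-private ia y ∘ toWitness)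

  same-or-adjacent : ∀ {a b} → inK a ≡ true → inK b ≡ true → a ≡ b ⊎ Adj H a b
  same-or-adjacent {a} {b} ka kb with a ≟ b
  ... | yes same = inj₁ same
  ... | no a≢b   = inj₂ (clique a b a≢b ka kb)

  via-private : ∀ {a b h} → Member a (suc h) → Member b (suc h) → a ≡ b ⊎ Adj H a b
  via-private (inj₁ refl)      (inj₁ refl)      = inj₁ refl
  via-private (inj₁ refl)      (inj₂ (_ , bh))  = inj₂ (adj-sym H bh)
  via-private (inj₂ (_ , ah))  (inj₁ refl)      = inj₂ ah
  via-private (inj₂ (sh , ah)) (inj₂ (_ , bh))  =
    same-or-adjacent (nbr-of-stable sh ah) (nbr-of-stable sh bh)

  edge-witness : ∀ {a b} → Adj H a b → ∃[ y ] (T (E a y) × T (E b y))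
  edge-witness {a} {b} ab with inK a in ia | inK b in ib
  ... | true  | true  = zero , fromWitness ia , fromWitness ib
  ... | true  | false = suc b , fromWitness (inj₂ (ib , ab)) , fromWitness (inj₁ refl)
  ... | false | true  = suc a , fromWitness (inj₁ refl) , fromWitness (inj₂ (ia , adj-sym H ab))
  ... | false | false = ⊥-elim (subst T (stable a b ia ib) ab)

  common-neighbour : ∀ a b → (∃[ y ] (T (E a y) × T (E b y))) ⇔ (a ≡ b ⊎ Adj H a b)
  common-neighbour a b = mk⇔
    (λ { (zero , ay , by)  → same-or-adjacent (toWitness ay) (toWitness by)
       ; (suc _ , ay , by) → via-private (toWitness ay) (toWitness by) })
    (λ { (inj₁ refl) → suc a , fromWitness (inj₁ refl) , fromWitness (inj₁ refl)
       ; (inj₂ ab)   → edge-witness ab })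

pullback : ∀ {n k m} {G : Graph n} {H : Graph k} (E : Fin k → Fin m → Bool) (c : Fin m) →
  (∀ a → InducesSubtree (StarAdj c) (λ y → T (E a y))) →
  (∀ a b → (∃[ y ] (T (E a y) × T (E b y))) ⇔ (a ≡ b ⊎ Adj H a b)) →
  (f : Fin n → Fin k) →
  (∀ u v → Adj G u v ⇔ (u ≢ v × (f u ≡ f v ⊎ Adj H (f u) (f v)))) →
  HalfSquareOfStarConvex G
pullback E c convex common f adjacency =
  _ , E ∘ f , inj₂ (c , convex ∘ f) , λ u v →
    ⇔.trans (adjacency u v) (⇔-id _ ×-⇔ ⇔.sym (common (f u) (f v)))

CondII⇒halfSquare : ∀ {n} (G : Graph n) → CondII G → HalfSquareOfStarConvex G
CondII⇒halfSquare G (_ , H , f , (inK , clique , stable) , _ , adjacency) =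
  pullback {G = G} {H = H} E zero star-convex common-neighbour f adjacency
  where open SplitRepresentation H inK clique stable

theorem2 : (n : ℕ) (G : Graph n) → HalfSquareOfStarConvex G ⇔ (CondI G ⊎ CondII G)
theorem2 n G = mk⇔ necessary sufficient
  where
  necessary : HalfSquareOfStarConvex G → CondI G ⊎ CondII G
  necessary (_ , E , inj₁ (c , convex) , half-square) =
    inj₁ (dominating⇒CondI G (xConvex⇒dominating G E c convex half-square))
  necessary (_ , E , inj₂ (c , convex) , half-square) =
    inj₂ (splitSubstitution⇒CondII (YConvex.splitSubstitution G E c convex half-square))

  sufficient : CondI G ⊎ CondII G → HalfSquareOfStarConvex G
  sufficient (inj₁ condI)  = CondI⇒halfSquare n G condI
  sufficient (inj₂ condII) = CondII⇒halfSquare G condII
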